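{- Let $\chi_1,\chi_2\colon G_K\to\overline{\mathbf{F}}_p^\times$ be continuous characters with $\chi_1\chi_2^{ -1}$ weakly generic, let $\sigma=\sigma_{a,b}$ be a Serre weight, and put $r_\tau=a_\tau-b_\tau+1$. Let $s,t\in\mathbf{Z}_{\ge0}^{\mathrm{Hom}_{\mathbf{F}_p}(k,\overline{\mathbf{F}}_p)}$ satisfy, for each $\tau$, $s_\tau+t_\tau=a_\tau-b_\tau+e$ and ($s_\tau\ge a_\tau-b_\tau+1$ or $t_\tau\ge a_\tau-b_\tau+1$), and $\chi_1|_{I_K}=\prod_\tau\omega_\tau^{s_\tau}$, $\chi_2|_{I_K}=\prod_\tau\omega_\tau^{t_\tau}$. Define $J=\{\tau: t_\tau\le e-1\}$ and $x_\tau=s_\tau$ for $\tau\notin J$, $x_\tau=s_\tau-r_\tau$ for $\tau\in J$. Suppose $(J,x)$ is the (unique) maximal element of $\mathcal{S}(\chi_1,\chi_2,\sigma)$. Then $J=\{\tau\in\mathrm{Hom}_{\mathbf{F}_p}(k,\overline{\mathbf{F}}_p): t_\tau<r_\tau\}$.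
   Context: Let $p$ be a prime and $K/\mathbf{Q}_p$ finite with residue field $k$, residue degree $f$, ramification index $e$. With $\varpi=\pi^{1/(p^f-1)}$ for a uniformiser $\pi$, let $\omega\colon G_K\to k^\times$, $g\mapsto$ image of $g(\varpi)/\varpi$, $\omega_\tau=\tau\circ\omega$, $\varphi(x)=x^p$, $\Omega_{\tau,a}=\sum_{i=0}^{f-1}p^ia_{\tau\circ\varphi^i}$. Serre weights $\sigma_{a,b}=\bigotimes_\tau(\det^{b_\tau}\otimes\mathrm{Sym}^{a_\tau-b_\tau}k^2)\otimes_{k,\tau}\overline{\mathbf{F}}_p$, $b_\tau,a_\tau-b_\tau\in[0,p-1]$, not all $b_\tau=p-1$. Write $\chi_1\chi_2^{ -1}=\psi\prod_\tau\omega_\tau^{n_\tau}$, $\psi$ unramified, $n_\tau\in[1,p]$, some $n_\tau<p$; weakly generic means $n_\tau\in[e,p-e]$ for all $\tau$. $\mathcal{S}(\chi_1,\chi_2,\sigma_{a,b})$ is the set of $(J,x)$, $J\subseteq\mathrm{Hom}_{\mathbf{F}_p}(k,\overline{\mathbf{F}}_p)$, $x_\tau\in[0,e-1]$, with $(\chi_1\oplus\chi_2)|_{I_K}\cong\prod_{\tau\in J}\omega_\tau^{a_\tau+1+x_\tau}\prod_{\tau\notin J}\omega_\tau^{b_\tau+x_\tau}\oplus\prod_{\tau\notin J}\omega_\tau^{a_\tau+e-x_\tau}\prod_{\tau\in J}\omega_\tau^{b_\tau+e-1-x_\tau}$. Put $s(J,x)_\tau=a_\tau-b_\tau+1+x_\tau$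 for $\tau\in J$ and $x_\tau$ for $\tau\notin J$; order by $(J,x)\preceq(J',x')$ iff $\Omega_{\tau,s(J',x')-s(J,x)}\in(p^f-1)\mathbf{Z}_{\ge0}$ for all $\tau$. A non-empty $\mathcal{S}$ has a unique maximal element (known fact). -}

module Defs where

open import Data.Nat as ℕ using (ℕ; zero; suc; NonZero; _≤_; _<_; _∸_; _^_; _≤?_; _<?_)
open import Data.Nat.DivMod using (_%_; m%n<n)
open import Data.Integer as ℤ using (ℤ; +_)
open import Data.Integer.Divisibility using (_∣_)
open import Data.Fin as Fin using (Fin; fromℕ<; toℕ)
open import Data.Fin.Subset using (Subset)
open import Data.Vec using (lookup; tabulate)
open import Data.Bool using (Bool; true; false; if_then_else_)
open import Data.Product using (_×_; ∃; Σ)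
open import Data.Sum using (_⊎_)
open import Relation.Nullary using (¬_; does)
open import Relation.Binary.PropositionalEquality using (_≡_)

-- Conventions: Hom_{F_p}(k, F̄_p) is identified with Fin f via i ↦ τ_i = τ_0 ∘ φ^i.
-- Then τ_j ∘ φ^i = τ_{(j+i) mod f} and ω_{τ_i} = ω_{τ_0}^{p^i}, and ω_{τ_0}|_{I_K} has
-- exact order p^f - 1.  A character of G_K is recorded by the exponent c ∈ ℤ with
-- χ|_{I_K} = ω_{τ_0}^c (well defined modulo p^f - 1).

Σℤ : ∀ {n} → (Fin n → ℤ) → ℤ
Σℤ {zero} g = + 0
Σℤ {suc n} g = g Fin.zero ℤ.+ Σℤ (λ i → g (Fin.suc i))

modulus : ℕ → ℕ → ℕ
modulus p f = p ^ f ∸ 1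

_≡[mod_]_ : ℤ → ℕ → ℤ → Set
x ≡[mod M ] y = + M ∣ (x ℤ.- y)

-- exponent of ∏_i ω_{τ_i}^{m_i} as a power of ω_{τ_0}:  Σ_i p^i m_i
expo : (p : ℕ) {f : ℕ} → (Fin f → ℤ) → ℤ
expo p m = Σℤ (λ i → + (p ^ toℕ i) ℤ.* m i)

shift : {f : ℕ} ⦃ _ : NonZero f ⦄ → Fin f → Fin f → Fin f
shift {f} j i = fromℕ< (m%n<n (toℕ j ℕ.+ toℕ i) f)

Ω : (p : ℕ) {f : ℕ} ⦃ _ : NonZero f ⦄ → Fin f → (Fin f → ℤ) → ℤ
Ω p j v = Σℤ (λ i → + (p ^ toℕ i) ℤ.* v (shift j i))

SerreWeight : (p : ℕ) {f : ℕ} → (a b : Fin f → ℕ) → Set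
SerreWeight p a b =
  (∀ i → (b i ≤ p ∸ 1) × (b i ≤ a i) × (a i ∸ b i ≤ p ∸ 1)) × ¬ (∀ i → b i ≡ p ∸ 1)

-- χ1 χ2^{-1} weakly generic, with c = inertial exponent of χ1 χ2^{-1}
WeaklyGeneric : (p e f : ℕ) → ℤ → Set
WeaklyGeneric p e f c =
  ∃ λ (n : Fin f → ℕ) →
    (∀ i → (1 ≤ n i) × (n i ≤ p)) × (∃ λ i → n i < p)
    × (c ≡[mod modulus p f ] expo p (λ i → + n i))
    × (∀ i → (e ≤ n i) × (n i ≤ p ∸ e))

-- membership (J , x) ∈ S(χ1, χ2, σ_{a,b})  (c1, c2 inertial exponents of χ1, χ2)
InS : (p e f : ℕ) (a b : Fin f → ℕ) (c1 c2 : ℤ) → Subset f → (Fin f → ℕ) → Set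
InS p e f a b c1 c2 J x =
  (∀ i → x i < e) ×
  (((c1 ≡[mod M ] A) × (c2 ≡[mod M ] B)) ⊎ ((c1 ≡[mod M ] B) × (c2 ≡[mod M ] A)))
  where
  M = modulus p f
  A = expo p (λ i → + (if lookup J i then a i ℕ.+ 1 ℕ.+ x i else b i ℕ.+ x i))
  B = expo p (λ i → + (if lookup J i then b i ℕ.+ e ∸ 1 ∸ x i else a i ℕ.+ e ∸ x i))

sJx : {f : ℕ} (a b : Fin f → ℕ) → Subset f → (Fin f → ℕ) → Fin f → ℕ
sJx a b J x i = if lookup J i then a i ∸ b i ℕ.+ 1 ℕ.+ x i else x i

Prec : (p f : ℕ) ⦃ _ : NonZero f ⦄ (a b : Fin f → ℕ) →
       Subset f → (Fin f → ℕ) → Subset f → (Fin f → ℕ) → Set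
Prec p f a b J x J' x' =
  ∀ j → ∃ λ (k : ℕ) →
    Ω p j (λ i → + sJx a b J' x' i ℤ.- + sJx a b J x i) ≡ + modulus p f ℤ.* + k

IsMaximalInS : (p e f : ℕ) ⦃ _ : NonZero f ⦄ (a b : Fin f → ℕ) (c1 c2 : ℤ) →
               Subset f → (Fin f → ℕ) → Set
IsMaximalInS p e f a b c1 c2 J x =
  InS p e f a b c1 c2 J x ×
  (∀ J' x' → InS p e f a b c1 c2 J' x' → Prec p f a b J x J' x' →
     (J' ≡ J) × (∀ i → x' i ≡ x i))

rw : {f : ℕ} (a b : Fin f → ℕ) → Fin f → ℕ
rw a b i = a i ∸ b i ℕ.+ 1

Jst : (e : ℕ) {f : ℕ} → (Fin f → ℕ) → Subset f
Jst e t = tabulate (λ i → does (t i ≤? e ∸ 1))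

xst : (e : ℕ) {f : ℕ} (a b s t : Fin f → ℕ) → Fin f → ℕ
xst e a b s t i = if lookup (Jst e t) i then s i ∸ rw a b i else s i

{-# OPTIONS --safe #-}
module Submission where

-- For τ ∈ J with x_τ + r_τ < e, moving τ out of J and raising x_τ by r_τ changes
-- neither the two characters in the definition of S nor s(J, x).  So for the maximal
-- element every τ ∈ J has e ≤ r_τ + x_τ = s_τ, whence t_τ ≤ a_τ - b_τ < r_τ.
-- Conversely, for τ ∉ J we have t_τ ≥ e, and t_τ < r_τ would force s_τ ≥ r_τ, making
-- s_τ + t_τ exceed a_τ - b_τ + e.

open import Defs
open import Data.Nat using (ℕ; NonZero; _≤_; _<?_; _+_; _∸_)
open import Data.Nat.Primality using (Prime)
open import Data.Integer using (ℤ; +_; _-_)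
open import Data.Fin using (Fin)
open import Data.Vec using (tabulate)
open import Data.Sum using (_⊎_)
open import Relation.Nullary using (does)
open import Relation.Binary.PropositionalEquality using (_≡_)

open import Data.Bool using (Bool; true; false; if_then_else_)
import Data.Fin as Fin
open import Data.Fin.Subset using (Subset)
open import Data.Integer as ℤ using (0ℤ)
import Data.Integer.Properties as ℤ
open import Data.Nat using (zero; suc; s≤s; _<_; _^_; _≤?_; >-nonZero)
open import Data.Nat.Properties
open import Data.Product using (_×_; _,_; proj₁; proj₂)
open import Data.Sum using ([_,_])
open import Data.Vec using (lookup; _[_]≔_)
open import Data.Vec.Functional using (updateAt)
open import Data.Vec.Functional.Properties using (updateAt-updates; updateAt-minimal)
open import Data.Vec.Properties using (lookup∘update; lookup∘update′; lookup∘tabulate; tabulate-cong)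
open import Function using (_∘_; mk⇔)
open import Relation.Nullary using (yes; no; contradiction)
open import Relation.Nullary.Decidable using (dec-true; does-⇔)
open import Relation.Binary.PropositionalEquality using (refl; sym; trans; cong; cong₂; subst; subst₂; _≢_; module ≡-Reasoning)

m+n≡o+p∧o≤m⇒n≤p : ∀ {m n o p} → m + n ≡ o + p → o ≤ m → n ≤ p
m+n≡o+p∧o≤m⇒n≤p {m} {n} {o} {p} eq o≤m =
  +-cancelˡ-≤ o n p (≤-trans (+-monoˡ-≤ n o≤m) (≤-reflexive eq))

m+n≡o+p∧o<m⇒n<p : ∀ {m n o p} → m + n ≡ o + p → o < m → n < p
m+n≡o+p∧o<m⇒n<p {m} {n} {o} {p} eq o<m =
  +-cancelˡ-< o n p (<-≤-trans (+-monoˡ-< n o<m) (≤-reflexive eq))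

Σℤ-cong : ∀ {n} {g h : Fin n → ℤ} → (∀ i → g i ≡ h i) → Σℤ g ≡ Σℤ h
Σℤ-cong {zero}  eq = refl
Σℤ-cong {suc n} eq = cong₂ ℤ._+_ (eq Fin.zero) (Σℤ-cong (eq ∘ Fin.suc))

Σℤ-zero : ∀ {n} {g : Fin n → ℤ} → (∀ i → g i ≡ 0ℤ) → Σℤ g ≡ 0ℤ
Σℤ-zero {zero}  eq = refl
Σℤ-zero {suc n} eq = cong₂ ℤ._+_ (eq Fin.zero) (Σℤ-zero (eq ∘ Fin.suc))

expo-cong : ∀ p {f} {m n : Fin f → ℤ} → (∀ i → m i ≡ n i) → expo p m ≡ expo p n
expo-cong p eq = Σℤ-cong (λ i → cong (+ (p ^ Fin.toℕ i) ℤ.*_) (eq i))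

Ω-zero : ∀ p {f} ⦃ _ : NonZero f ⦄ (j : Fin f) {v : Fin f → ℤ} → (∀ i → v i ≡ 0ℤ) → Ω p j v ≡ 0ℤ
Ω-zero p j eq = Σℤ-zero (λ i → trans (cong (+ (p ^ Fin.toℕ i) ℤ.*_) (eq (shift j i)))
                                      (ℤ.*-zeroʳ (+ (p ^ Fin.toℕ i))))

update-pointwise : ∀ {n} {A : Set} (P : Fin n → Bool → A → Set)
  (J : Subset n) (x : Fin n → A) (i : Fin n) {β : Bool} {h : A → A} →
  P i β (h (x i)) → (∀ j → P j (lookup J j) (x j)) →
  ∀ j → P j (lookup (J [ i ]≔ β) j) (updateAt x i h j)
update-pointwise P J x i {β} Pi Pall j with j Fin.≟ i
... | yes refl = subst₂ (P i) (sym (lookup∘update i J β)) (sym (updateAt-updates i x)) Pi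
... | no j≢i   = subst₂ (P j) (sym (lookup∘update′ j≢i J β))
                               (sym (updateAt-minimal j i x j≢i)) (Pall j)

m+[n∸m+1+o]≡n+1+o : ∀ {m n} o → m ≤ n → m + (n ∸ m + 1 + o) ≡ n + 1 + o
m+[n∸m+1+o]≡n+1+o {m} {n} o m≤n = begin
  m + (n ∸ m + 1 + o)   ≡⟨ sym (+-assoc m _ o) ⟩
  m + (n ∸ m + 1) + o   ≡⟨ cong (_+ o) (sym (+-assoc m (n ∸ m) 1)) ⟩
  m + (n ∸ m) + 1 + o   ≡⟨ cong (λ k → k + 1 + o) (m+[n∸m]≡n m≤n) ⟩
  n + 1 + o             ∎
  where open ≡-Reasoning

n+p∸[n∸m+1+o]≡m+p∸1∸o : ∀ {m n} p o → m ≤ n → n + p ∸ (n ∸ m + 1 + o) ≡ m + p ∸ 1 ∸ o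
n+p∸[n∸m+1+o]≡m+p∸1∸o {m} {n} p o m≤n = begin
  n + p ∸ (n ∸ m + 1 + o)             ≡⟨ cong₂ _∸_ n+p≡ (+-assoc (n ∸ m) 1 o) ⟩
  n ∸ m + (m + p) ∸ (n ∸ m + (1 + o)) ≡⟨ [m+n]∸[m+o]≡n∸o (n ∸ m) (m + p) (1 + o) ⟩
  m + p ∸ (1 + o)                     ≡⟨ sym (∸-+-assoc (m + p) 1 o) ⟩
  m + p ∸ 1 ∸ o                       ∎
  where
  open ≡-Reasoning
  n+p≡ : n + p ≡ n ∸ m + (m + p)
  n+p≡ = begin
    n + p             ≡⟨ cong (_+ p) (sym (m+[n∸m]≡n m≤n)) ⟩
    m + (n ∸ m) + p   ≡⟨ cong (_+ p) (+-comm m (n ∸ m)) ⟩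
    n ∸ m + m + p     ≡⟨ +-assoc (n ∸ m) m p ⟩
    n ∸ m + (m + p)   ∎

module _ {p e f : ℕ} (a b : Fin f → ℕ) (c1 c2 : ℤ) {J : Subset f} {x : Fin f → ℕ} {i : Fin f}
         (i∈J : lookup J i ≡ true) where

  private
    J⁻ : Subset f
    J⁻ = J [ i ]≔ false

    x⁺ : Fin f → ℕ
    x⁺ = updateAt x i (λ y → rw a b i + y)

    exchange-invariant : (g : Fin f → Bool → ℕ → ℕ) →
                         g i false (rw a b i + x i) ≡ g i true (x i) →
                         ∀ j → g j (lookup J⁻ j) (x⁺ j) ≡ g j (lookup J j) (x j)
    exchange-invariant g eq =
      update-pointwise (λ j β y → g j β y ≡ g j (lookup J j) (x j)) J x i
        (trans eq (cong (λ β → g i β (x i)) (sym i∈J))) (λ _ → refl)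

    J⁻≢J : J⁻ ≢ J
    J⁻≢J J⁻≡J with trans (sym (lookup∘update i J false)) (trans (cong (λ K → lookup K i) J⁻≡J) i∈J)
    ... | ()

    exchange-InS : b i ≤ a i → rw a b i + x i < e →
                   InS p e f a b c1 c2 J x → InS p e f a b c1 c2 J⁻ x⁺
    exchange-InS b≤a r+x<e (x<e , congruent) =
      update-pointwise (λ _ _ y → y < e) J x i {β = false} r+x<e x<e ,
      subst₂ (λ A B → ((c1 ≡[mod M ] A) × (c2 ≡[mod M ] B)) ⊎ ((c1 ≡[mod M ] B) × (c2 ≡[mod M ] A)))
        (sym (expo-cong p (cong +_ ∘ A-invariant))) (sym (expo-cong p (cong +_ ∘ B-invariant))) congruent
      where
      M : ℕ
      M = modulus p f
      A-invariant : ∀ j → (if lookup J⁻ j then a j + 1 + x⁺ j else b j + x⁺ j)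
                        ≡ (if lookup J j then a j + 1 + x j else b j + x j)
      A-invariant = exchange-invariant (λ j β y → if β then a j + 1 + y else b j + y)
                                       (m+[n∸m+1+o]≡n+1+o (x i) b≤a)
      B-invariant : ∀ j → (if lookup J⁻ j then b j + e ∸ 1 ∸ x⁺ j else a j + e ∸ x⁺ j)
                        ≡ (if lookup J j then b j + e ∸ 1 ∸ x j else a j + e ∸ x j)
      B-invariant = exchange-invariant (λ j β y → if β then b j + e ∸ 1 ∸ y else a j + e ∸ y)
                                       (n+p∸[n∸m+1+o]≡m+p∸1∸o e (x i) b≤a)

    exchange-⪰ : ⦃ _ : NonZero f ⦄ → Prec p f a b J x J⁻ x⁺
    exchange-⪰ j = 0 , trans (Ω-zero p j (λ k → ℤ.i≡j⇒i-j≡0 (cong +_ (s-invariant k))))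
                             (sym (ℤ.*-zeroʳ (+ modulus p f)))
      where
      s-invariant : ∀ k → sJx a b J⁻ x⁺ k ≡ sJx a b J x k
      s-invariant = exchange-invariant (λ j β y → if β then a j ∸ b j + 1 + y else y) refl

  maximal⇒e≤r+x : ⦃ _ : NonZero f ⦄ → b i ≤ a i →
                  IsMaximalInS p e f a b c1 c2 J x → e ≤ rw a b i + x i
  maximal⇒e≤r+x b≤a (inS , maximal) = ≮⇒≥ λ r+x<e →
    J⁻≢J (proj₁ (maximal J⁻ x⁺ (exchange-InS b≤a r+x<e inS) exchange-⪰))

mainTheorem7 : (p e f : ℕ) ⦃ _ : NonZero f ⦄ → Prime p → 1 ≤ e →
    (a b : Fin f → ℕ) → SerreWeight p a b →
    (c1 c2 : ℤ) → WeaklyGeneric p e f (c1 - c2) →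
    (s t : Fin f → ℕ) →
    (∀ i → s i + t i ≡ a i ∸ b i + e) →
    (∀ i → (rw a b i ≤ s i) ⊎ (rw a b i ≤ t i)) →
    c1 ≡[mod modulus p f ] expo p (λ i → + s i) →
    c2 ≡[mod modulus p f ] expo p (λ i → + t i) →
    IsMaximalInS p e f a b c1 c2 (Jst e t) (xst e a b s t) →
    Jst e t ≡ tabulate (λ i → does (t i <? rw a b i))
mainTheorem7 p e f _ 1≤e a b (weight , _) c1 c2 _ s t s+t≡ r≤s⊎r≤t _ _ maximal =
  tabulate-cong λ i → does-⇔ (mk⇔ (∈J⇒t<r i) (t<r⇒∈J i)) (t i ≤? e ∸ 1) (t i <? rw a b i)
  where
  r≡suc : ∀ i → rw a b i ≡ suc (a i ∸ b i)
  r≡suc i = +-comm (a i ∸ b i) 1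

  t<r⇒∈J : ∀ i → t i < rw a b i → t i ≤ e ∸ 1
  t<r⇒∈J i t<r = [ (λ r≤s → <⇒≤pred (m+n≡o+p∧o<m⇒n<p (s+t≡ i) (subst (_≤ s i) (r≡suc i) r≤s)))
                 , (λ r≤t → contradiction r≤t (<⇒≱ t<r)) ] (r≤s⊎r≤t i)

  ∈J⇒t<r : ∀ i → t i ≤ e ∸ 1 → t i < rw a b i
  ∈J⇒t<r i t≤e∸1 = subst (t i <_) (sym (r≡suc i)) (s≤s t≤a∸b)
    where
    i∈J : lookup (Jst e t) i ≡ true
    i∈J = trans (lookup∘tabulate _ i) (dec-true (t i ≤? e ∸ 1) t≤e∸1)
    a∸b<s : a i ∸ b i < s i
    a∸b<s = m+n≡o+p∧o<m⇒n<p (trans (+-comm e _) (trans (sym (s+t≡ i)) (+-comm (s i) (t i))))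
                            (m≤pred[n]⇒suc[m]≤n ⦃ >-nonZero 1≤e ⦄ t≤e∸1)
    r+x≡s : rw a b i + xst e a b s t i ≡ s i
    r+x≡s = trans (cong (λ β → rw a b i + (if β then s i ∸ rw a b i else s i)) i∈J)
                  (m+[n∸m]≡n (subst (_≤ s i) (sym (r≡suc i)) a∸b<s))
    e≤s : e ≤ s i
    e≤s = subst (e ≤_) r+x≡s (maximal⇒e≤r+x a b c1 c2 i∈J (proj₁ (proj₂ (weight i))) maximal)
    t≤a∸b : t i ≤ a i ∸ b i
    t≤a∸b = m+n≡o+p∧o≤m⇒n≤p (trans (s+t≡ i) (+-comm _ e)) e≤s
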